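{- Let $n\geq 3$ and let $d_1\geq d_2\geq\cdots\geq d_n>0$ be the degree sequence of a triangular multigraph on $n$ vertices. Then $\sum_{i=1}^n d_i$ is even and $d_1\leq \sum_{i=2}^n (d_i-1)$.
   Context: A multigraph is a finite graph in which multiple edges (and possibly loops) are allowed; the degree of a vertex is the number of incident edges counted with multiplicity. A triangle in a multigraph consists of three distinct vertices which are pairwise adjacent. A multigraph is triangular if every edge is contained in a triangle. A sequence $(d_1,\dots,d_n)$ is the degree sequence of a multigraph if the multigraph has vertices $v_1,\dots,v_n$ with $\deg(v_i)=d_i$ for all $i$. -}

module Defs where

open import Data.Nat using (ℕ; _+_)
open import Data.Fin using (Fin; _≟_)
open import Data.List using (List; map; tabulate)
open import Data.Nat.ListAction using (sum)
open import Data.List.Membership.Propositional using (_∈_)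
open import Data.Product using (_×_; _,_; ∃)
open import Data.Sum using (_⊎_)
open import Relation.Nullary using (¬_; yes; no)
open import Relation.Binary.PropositionalEquality using (_≡_)

-- A multigraph on vertex set Fin n: a finite list of edges, each an
-- (unordered, recorded as ordered) pair of endpoints. Repeated entries are
-- multiple edges; an entry (v , v) is a loop.
record Multigraph (n : ℕ) : Set where
  constructor mkMultigraph
  field
    edges : List (Fin n × Fin n)
open Multigraph public

δ : ∀ {n} → Fin n → Fin n → ℕ
δ u v with u ≟ v
... | yes _ = 1
... | no  _ = 0

-- number of endpoints of edge e equal to v (a loop contributes 2)
incidence : ∀ {n} → Fin n × Fin n → Fin n → ℕ
incidence (u , w) v = δ u v + δ w v

degree : ∀ {n} → Multigraph n → Fin n → ℕ
degree G v = sum (map (λ e → incidence e v) (edges G))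

Adjacent : ∀ {n} → Multigraph n → Fin n → Fin n → Set
Adjacent G u w = ((u , w) ∈ edges G) ⊎ ((w , u) ∈ edges G)

Triangle : ∀ {n} → Multigraph n → Fin n → Fin n → Fin n → Set
Triangle G u v w =
  ¬ u ≡ v × ¬ v ≡ w × ¬ u ≡ w ×
  Adjacent G u v × Adjacent G v w × Adjacent G u w

Triangular : ∀ {n} → Multigraph n → Set
Triangular G = ∀ {u w} → (u , w) ∈ edges G → ∃ λ x → Triangle G u w x

Σᶠ : ∀ {n} → (Fin n → ℕ) → ℕ
Σᶠ f = sum (tabulate f)

{-# OPTIONS --safe #-}

-- Summing degrees counts every edge twice. For the bound, write deg v₁ as the
-- sum over j ≥ 2 of the number μ(v₁, vⱼ) of edges joining v₁ and vⱼ (a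
-- triangular multigraph has no loops, so μ(v₁, v₁) = 0). If μ(v₁, vⱼ) > 0, an
-- edge v₁vⱼ lies in a triangle v₁vⱼx, and its edge vⱼx is incident to vⱼ
-- without joining vⱼ to v₁; hence μ(v₁, vⱼ) ≤ dⱼ − 1.
module Submission where

open import Defs
open import Data.Nat using (ℕ; suc; _≤_; _<_; _∸_)
open import Data.Nat.Divisibility using (_∣_)
open import Data.Fin using (Fin; zero) renaming (suc to fsuc; _≤_ to _≤ᶠ_)
open import Data.Product using (_×_; ∃)
open import Relation.Binary.PropositionalEquality using (_≡_)

open import Data.Empty using (⊥-elim)
open import Data.Fin using (_≟_)
open import Data.List using (List; []; _∷_; map; length)
open import Data.List.Membership.Propositional using (_∈_)
open import Data.List.Properties using (map-cong; tabulate-cong)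
open import Data.List.Relation.Unary.Any using (here; there)
open import Data.Nat using (zero; _+_; _*_; z≤n; z<s; _<?_)
open import Data.Nat.Divisibility using (divides)
open import Data.Nat.ListAction using (sum)
open import Data.Nat.Properties
  using ( +-*-semiring; +-comm; +-identityʳ; *-identityʳ; *-zeroʳ
        ; ≤-reflexive; ≤-trans; +-mono-≤; +-mono-<-≤; +-mono-≤-<
        ; n≮0; n≤0⇒n≡0; ≮⇒≥; <⇒≤pred; module ≤-Reasoning )
open import Data.Product using (_,_)
open import Algebra.Properties.Semiring.Sum +-*-semiring as ∑
  using (∑-distrib-+; *-distribˡ-sum; sum-replicate-zero)
open import Data.Sum using (_⊎_; inj₁; inj₂; [_,_])
open import Function using (_∘_)
open import Relation.Nullary using (¬_; yes; no)
open import Relation.Binary.PropositionalEquality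
  using (refl; sym; trans; cong; cong₂; subst; module ≡-Reasoning)

δ-refl : ∀ {n} (u : Fin n) → δ u u ≡ 1
δ-refl u with u ≟ u
... | yes _ = refl
... | no u≢u = ⊥-elim (u≢u refl)

δ-≢ : ∀ {n} {u v : Fin n} → ¬ u ≡ v → δ u v ≡ 0
δ-≢ {u = u} {v} u≢v with u ≟ v
... | yes u≡v = ⊥-elim (u≢v u≡v)
... | no _ = refl

δ-suc : ∀ {n} (u v : Fin n) → δ (fsuc u) (fsuc v) ≡ δ u v
δ-suc u v with u ≟ v
... | yes _ = refl
... | no _ = refl

δ*n≤n : ∀ {k} (u v : Fin k) n → δ u v * n ≤ n
δ*n≤n u v n with u ≟ v
... | yes _ = ≤-reflexive (+-identityʳ n)
... | no _ = z≤n

Σᶠ≡sum : ∀ {n} (f : Fin n → ℕ) → Σᶠ f ≡ ∑.sum f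
Σᶠ≡sum {zero} f = refl
Σᶠ≡sum {suc n} f = cong (f zero +_) (Σᶠ≡sum (λ i → f (fsuc i)))

Σᶠ-cong : ∀ {n} {f g : Fin n → ℕ} → (∀ i → f i ≡ g i) → Σᶠ f ≡ Σᶠ g
Σᶠ-cong f≗g = cong sum (tabulate-cong f≗g)

Σᶠ-mono : ∀ {n} {f g : Fin n → ℕ} → (∀ i → f i ≤ g i) → Σᶠ f ≤ Σᶠ g
Σᶠ-mono {zero} f≤g = z≤n
Σᶠ-mono {suc n} f≤g = +-mono-≤ (f≤g zero) (Σᶠ-mono (λ i → f≤g (fsuc i)))

Σᶠ-zero : ∀ n → Σᶠ {n} (λ _ → 0) ≡ 0
Σᶠ-zero n = trans (Σᶠ≡sum {n} (λ _ → 0)) (sum-replicate-zero n)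

Σᶠ-distrib-+ : ∀ {n} (f g : Fin n → ℕ) → Σᶠ (λ i → f i + g i) ≡ Σᶠ f + Σᶠ g
Σᶠ-distrib-+ f g = begin
  Σᶠ (λ i → f i + g i)   ≡⟨ Σᶠ≡sum (λ i → f i + g i) ⟩
  ∑.sum (λ i → f i + g i) ≡⟨ ∑-distrib-+ f g ⟩
  ∑.sum f + ∑.sum g       ≡⟨ sym (cong₂ _+_ (Σᶠ≡sum f) (Σᶠ≡sum g)) ⟩
  Σᶠ f + Σᶠ g             ∎
  where open ≡-Reasoning

*-distribˡ-Σᶠ : ∀ {n} c (f : Fin n → ℕ) → c * Σᶠ f ≡ Σᶠ (λ i → c * f i)
*-distribˡ-Σᶠ c f = begin
  c * Σᶠ f               ≡⟨ cong (c *_) (Σᶠ≡sum f) ⟩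
  c * ∑.sum f            ≡⟨ *-distribˡ-sum c f ⟩
  ∑.sum (λ i → c * f i)  ≡⟨ sym (Σᶠ≡sum (λ i → c * f i)) ⟩
  Σᶠ (λ i → c * f i)     ∎
  where open ≡-Reasoning

Σᶠ-δ : ∀ {n} (w : Fin n) → Σᶠ (δ w) ≡ 1
Σᶠ-δ {suc n} zero = cong suc (Σᶠ-zero n)
Σᶠ-δ {suc n} (fsuc w) = trans (Σᶠ-cong (δ-suc w)) (Σᶠ-δ w)

Σᶠ-sum-comm : ∀ {n} {A : Set} (h : A → Fin n → ℕ) (xs : List A) →
  Σᶠ (λ i → sum (map (λ x → h x i) xs)) ≡ sum (map (λ x → Σᶠ (h x)) xs)
Σᶠ-sum-comm {n} h [] = Σᶠ-zero n
Σᶠ-sum-comm h (x ∷ xs) =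
  trans (Σᶠ-distrib-+ (h x) _) (cong (Σᶠ (h x) +_) (Σᶠ-sum-comm h xs))

module _ {A : Set} {f g : A → ℕ} where

  sum-map-mono : ∀ xs → (∀ x → f x ≤ g x) → sum (map f xs) ≤ sum (map g xs)
  sum-map-mono [] f≤g = z≤n
  sum-map-mono (x ∷ xs) f≤g = +-mono-≤ (f≤g x) (sum-map-mono xs f≤g)

  sum-map-mono-< : ∀ xs → (∀ x → f x ≤ g x) → ∀ {y} → y ∈ xs → f y < g y →
    sum (map f xs) < sum (map g xs)
  sum-map-mono-< (x ∷ xs) f≤g (here refl) fy<gy = +-mono-<-≤ fy<gy (sum-map-mono xs f≤g)
  sum-map-mono-< (x ∷ xs) f≤g (there y∈xs) fy<gy = +-mono-≤-< (f≤g x) (sum-map-mono-< xs f≤g y∈xs fy<gy)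

sum-map-pos : ∀ {A : Set} (f : A → ℕ) xs → 0 < sum (map f xs) → ∃ λ x → x ∈ xs × 0 < f x
sum-map-pos f (x ∷ xs) pos with f x in fx≡
... | suc _ = x , here refl , subst (0 <_) (sym fx≡) z<s
... | zero with sum-map-pos f xs pos
...   | y , y∈xs , 0<fy = y , there y∈xs , 0<fy

sum-map-const : ∀ {A : Set} c (xs : List A) → sum (map (λ _ → c) xs) ≡ length xs * c
sum-map-const c [] = refl
sum-map-const c (x ∷ xs) = cong (c +_) (sum-map-const c xs)

-- The ends of e at u whose other end is w; a loop at u counts twice in joins u u.
joins : ∀ {n} → Fin n → Fin n → Fin n × Fin n → ℕ
joins u w (a , b) = δ a u * δ b w + δ b u * δ a w

multiplicity : ∀ {n} → Multigraph n → Fin n → Fin n → ℕ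
multiplicity G u w = sum (map (joins u w) (edges G))

Σᶠ-incidence : ∀ {n} (e : Fin n × Fin n) → Σᶠ (incidence e) ≡ 2
Σᶠ-incidence (a , b) = trans (Σᶠ-distrib-+ (δ a) (δ b)) (cong₂ _+_ (Σᶠ-δ a) (Σᶠ-δ b))

Σᶠ-joins : ∀ {n} (u : Fin n) e → Σᶠ (λ w → joins u w e) ≡ incidence e u
Σᶠ-joins u (a , b) = begin
  Σᶠ (λ w → δ a u * δ b w + δ b u * δ a w)
    ≡⟨ Σᶠ-distrib-+ (λ w → δ a u * δ b w) (λ w → δ b u * δ a w) ⟩
  Σᶠ (λ w → δ a u * δ b w) + Σᶠ (λ w → δ b u * δ a w)
    ≡⟨ sym (cong₂ _+_ (*-distribˡ-Σᶠ (δ a u) (δ b)) (*-distribˡ-Σᶠ (δ b u) (δ a))) ⟩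
  δ a u * Σᶠ (δ b) + δ b u * Σᶠ (δ a)
    ≡⟨ cong₂ _+_ (cong (δ a u *_) (Σᶠ-δ b)) (cong (δ b u *_) (Σᶠ-δ a)) ⟩
  δ a u * 1 + δ b u * 1
    ≡⟨ cong₂ _+_ (*-identityʳ (δ a u)) (*-identityʳ (δ b u)) ⟩
  δ a u + δ b u ∎
  where open ≡-Reasoning

joins≤incidence : ∀ {n} (u w : Fin n) e → joins u w e ≤ incidence e w
joins≤incidence u w (a , b) =
  subst (joins u w (a , b) ≤_) (+-comm (δ b w) (δ a w))
    (+-mono-≤ (δ*n≤n a u (δ b w)) (δ*n≤n b u (δ a w)))

joins-pos : ∀ {n} {u w : Fin n} e → 0 < joins u w e → e ≡ (u , w) ⊎ e ≡ (w , u)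
joins-pos {u = u} {w} (a , b) pos with a ≟ u | b ≟ w | b ≟ u | a ≟ w
... | yes refl | yes refl | _      | _      = inj₁ refl
... | _        | _        | yes refl | yes refl = inj₂ refl
... | no _     | _        | no _   | _      = ⊥-elim (n≮0 pos)
... | no _     | _        | yes _  | no _   = ⊥-elim (n≮0 pos)
... | yes _    | no _     | no _   | _      = ⊥-elim (n≮0 pos)
... | yes _    | no _     | yes _  | no _   = ⊥-elim (n≮0 pos)

joins<incidence-outgoing : ∀ {n} {u w x : Fin n} → ¬ x ≡ u → ¬ x ≡ w →
  joins u w (w , x) < incidence (w , x) w
joins<incidence-outgoing {u = u} {w} x≢u x≢w
  rewrite δ-≢ x≢u | δ-≢ x≢w | δ-refl w | *-zeroʳ (δ w u) = z<s

joins<incidence-incoming : ∀ {n} {u w x : Fin n} → ¬ x ≡ u → ¬ x ≡ w →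
  joins u w (x , w) < incidence (x , w) w
joins<incidence-incoming {u = u} {w} x≢u x≢w
  rewrite δ-≢ x≢u | δ-≢ x≢w | δ-refl w | *-zeroʳ (δ w u) = z<s

module _ {n} (G : Multigraph n) where

  handshake : Σᶠ (degree G) ≡ length (edges G) * 2
  handshake = begin
    Σᶠ (degree G)                                  ≡⟨ Σᶠ-sum-comm incidence (edges G) ⟩
    sum (map (λ e → Σᶠ (incidence e)) (edges G))  ≡⟨ cong sum (map-cong Σᶠ-incidence (edges G)) ⟩
    sum (map (λ _ → 2) (edges G))                  ≡⟨ sum-map-const 2 (edges G) ⟩
    length (edges G) * 2                           ∎
    where open ≡-Reasoning

  degree≡Σᶠ-multiplicity : ∀ u → degree G u ≡ Σᶠ (multiplicity G u)
  degree≡Σᶠ-multiplicity u = begin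
    sum (map (λ e → incidence e u) (edges G))          ≡⟨ cong sum (map-cong (λ e → sym (Σᶠ-joins u e)) (edges G)) ⟩
    sum (map (λ e → Σᶠ (λ w → joins u w e)) (edges G)) ≡⟨ sym (Σᶠ-sum-comm (λ e w → joins u w e) (edges G)) ⟩
    Σᶠ (multiplicity G u)                               ∎
    where open ≡-Reasoning

  multiplicity-pos : ∀ {u w} → 0 < multiplicity G u w → Adjacent G u w
  multiplicity-pos pos with sum-map-pos _ (edges G) pos
  ... | e , e∈E , 0<joins with joins-pos e 0<joins
  ...   | inj₁ refl = inj₁ e∈E
  ...   | inj₂ refl = inj₂ e∈E

  module _ (triangular : Triangular G) where

    loop-free : ∀ {u} → ¬ (u , u) ∈ edges G
    loop-free uu∈E with triangular uu∈E
    ... | _ , u≢u , _ = u≢u refl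

    multiplicity-self : ∀ u → multiplicity G u u ≡ 0
    multiplicity-self u = n≤0⇒n≡0 (≮⇒≥ λ pos → [ loop-free , loop-free ] (multiplicity-pos pos))

    third-vertex : ∀ {u w} → Adjacent G u w → ∃ λ x → ¬ x ≡ u × ¬ x ≡ w × Adjacent G w x
    third-vertex (inj₁ uw∈E) with triangular uw∈E
    ... | x , _ , w≢x , u≢x , _ , wx , _ = x , (u≢x ∘ sym) , (w≢x ∘ sym) , wx
    third-vertex (inj₂ wu∈E) with triangular wu∈E
    ... | x , _ , u≢x , w≢x , _ , _ , wx = x , (u≢x ∘ sym) , (w≢x ∘ sym) , wx

    multiplicity<degree : ∀ {u w} → 0 < multiplicity G u w → multiplicity G u w < degree G w
    multiplicity<degree {u} {w} pos with third-vertex (multiplicity-pos pos)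
    ... | x , x≢u , x≢w , inj₁ wx∈E =
      sum-map-mono-< (edges G) (joins≤incidence u w) wx∈E (joins<incidence-outgoing x≢u x≢w)
    ... | x , x≢u , x≢w , inj₂ xw∈E =
      sum-map-mono-< (edges G) (joins≤incidence u w) xw∈E (joins<incidence-incoming x≢u x≢w)

    multiplicity≤degree∸1 : ∀ u w → multiplicity G u w ≤ degree G w ∸ 1
    multiplicity≤degree∸1 u w with 0 <? multiplicity G u w
    ... | yes pos = <⇒≤pred (multiplicity<degree pos)
    ... | no ¬pos = ≤-trans (≮⇒≥ ¬pos) z≤n

lemma1p4 : (m : ℕ) → 3 ≤ suc m → (d : Fin (suc m) → ℕ) →
    (∀ i j → i ≤ᶠ j → d j ≤ d i) → (∀ i → 0 < d i) →
    (∃ λ (G : Multigraph (suc m)) → Triangular G × (∀ i → degree G i ≡ d i)) →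
    (2 ∣ Σᶠ d) × (d zero ≤ Σᶠ (λ (j : Fin m) → d (fsuc j) ∸ 1))
lemma1p4 m _ d _ _ (G , triangular , deg≡d) = even , bound
  where
  μ₁ : Fin (suc m) → ℕ
  μ₁ = multiplicity G zero

  even : 2 ∣ Σᶠ d
  even = divides (length (edges G)) (trans (Σᶠ-cong (sym ∘ deg≡d)) (handshake G))

  bound : d zero ≤ Σᶠ (λ (j : Fin m) → d (fsuc j) ∸ 1)
  bound = begin
    d zero                                ≡⟨ sym (deg≡d zero) ⟩
    degree G zero                         ≡⟨ degree≡Σᶠ-multiplicity G zero ⟩
    μ₁ zero + Σᶠ (λ j → μ₁ (fsuc j))      ≡⟨ cong (_+ Σᶠ (λ j → μ₁ (fsuc j))) (multiplicity-self G triangular zero) ⟩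
    Σᶠ (λ j → μ₁ (fsuc j))                ≤⟨ Σᶠ-mono (λ j → multiplicity≤degree∸1 G triangular zero (fsuc j)) ⟩
    Σᶠ (λ j → degree G (fsuc j) ∸ 1)      ≡⟨ Σᶠ-cong (λ j → cong (_∸ 1) (deg≡d (fsuc j))) ⟩
    Σᶠ (λ j → d (fsuc j) ∸ 1)             ∎
    where open ≤-Reasoning
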